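{- Let $\mathbf{BoolGal}$ be the full subcategory of $\mathbf{OMLatGal}$ on the Boolean algebras. Then $\mathbf{BoolGal}$ is closed under the dagger kernels and the finite dagger biproducts of $\mathbf{OMLatGal}$ (so it is a dagger kernel category with dagger biproducts), and as a dagger kernel category it is Boolean: for all kernels $m,n$ with the same codomain, $m\wedge n=0$ in $\mathrm{KSub}$ implies $m^\dagger\circ n=0$.
   Context: An orthomodular lattice is a bounded lattice with orthocomplement $x\mapsto x^\perp$ ($x^{\perp\perp}=x$, order-reversing, $x\wedge x^\perp=0$) with $x\le y\Rightarrow y=x\vee(x^\perp\wedge y)$; Boolean algebras are the distributive ones. $\mathbf{OMLatGal}$: objects orthomodular lattices; morphisms $f\colon X\to Y$ pairs $(f_*,f^*)$ of order-reversing maps $f_*\colon X\to Y$, $f^*\colon Y\to X$ with $x\le f^*(y)\iff y\le f_*(x)$; identity $((-)^\perp,(-)^\perp)$; composition $(g\circ f)_*=g_*\circ(-)^\perp\circ f_*$, $(g\circ f)^*=f^*\circ(-)^\perp\circ g^*$; dagger $(f_*,f^*)^\dagger=(f^*,f_*)$. It is a dagger kernel category in which the kernel of $f\colon X\to Y$ is $k\colon{\downarrow}k\to X$ for $k=f^*(1)$ (where ${\downarrow}k=\{u\le k\}$ with orthocomplement $u\mapsto k\wedge u^\perp$, $k_*(u)=u^\perp$, $k^*(x)=k\wedge x^\perp$), and with dagger biproduct $X_1\oplus X_2$ the product lattice with coprojection $(\kappa_1)_*(x)=(x^\perp,1)$, $(\kappa_1)^*(x,y)=x^\perp$ (similarly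 $\kappa_2$). In a dagger kernel category, $\mathrm{KSub}(X)$ denotes the poset of dagger kernels into $X$ up to isomorphism, with meet $\wedge$ and bottom $0$. -}

module Defs where

open import Data.Product using (Σ; Σ-syntax; _×_; _,_; proj₁; proj₂)
open import Data.Unit using (⊤; tt)
open import Relation.Binary.Core using (Rel)
open import Relation.Binary.Lattice.Structures using (IsBoundedLattice)
open import Algebra.Definitions using (_DistributesOverˡ_)
open import Function.Bundles using (_⇔_)

record OStr : Set₁ where
  infix 4 _≈_ _≤_
  infixr 7 _∧_
  infixr 6 _∨_
  field
    Carrier : Set
    _≈_     : Rel Carrier _
    _≤_     : Rel Carrier _
    _∨_     : Carrier → Carrier → Carrier
    _∧_     : Carrier → Carrier → Carrier
    𝟙       : Carrier
    𝟘       : Carrier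
    _ᗮ      : Carrier → Carrier

record IsOML (X : OStr) : Set where
  open OStr X
  field
    isBoundedLattice : IsBoundedLattice _≈_ _≤_ _∨_ _∧_ 𝟙 𝟘
    ᗮ-involutive     : ∀ x → (x ᗮ) ᗮ ≈ x
    ᗮ-antitone       : ∀ {x y} → x ≤ y → y ᗮ ≤ x ᗮ
    ∧-ᗮ              : ∀ x → x ∧ (x ᗮ) ≈ 𝟘
    orthomodular     : ∀ {x y} → x ≤ y → y ≈ x ∨ ((x ᗮ) ∧ y)
  open IsBoundedLattice isBoundedLattice public

record IsBool (X : OStr) : Set where
  open OStr X
  field
    isOML        : IsOML X
    ∧-distribˡ-∨ : _DistributesOverˡ_ _≈_ _∧_ _∨_
  open IsOML isOML public

record RawHom (X Y : OStr) : Set where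
  constructor ⟨_,_⟩
  field
    low : OStr.Carrier X → OStr.Carrier Y   -- f_*
    up  : OStr.Carrier Y → OStr.Carrier X   -- f^*
open RawHom public

record Hom (X Y : OStr) : Set where
  private
    module X = OStr X
    module Y = OStr Y
  field
    raw        : RawHom X Y
    low-antitone : ∀ {x x′} → x X.≤ x′ → low raw x′ Y.≤ low raw x
    up-antitone  : ∀ {y y′} → y Y.≤ y′ → up raw y′ X.≤ up raw y
    galois     : ∀ x y → (x X.≤ up raw y) ⇔ (y Y.≤ low raw x)
open Hom public

_≋_ : ∀ {X Y} → RawHom X Y → RawHom X Y → Set
_≋_ {X} {Y} f g =
  (∀ x → OStr._≈_ Y (low f x) (low g x)) × (∀ y → OStr._≈_ X (up f y) (up g y))

idR : (X : OStr) → RawHom X X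
idR X = ⟨ OStr._ᗮ X , OStr._ᗮ X ⟩

infixr 9 _∘R_
_∘R_ : ∀ {X Y Z} → RawHom Y Z → RawHom X Y → RawHom X Z
_∘R_ {Y = Y} g f =
  ⟨ (λ x → low g (OStr._ᗮ Y (low f x))) , (λ z → up f (OStr._ᗮ Y (up g z))) ⟩

_† : ∀ {X Y} → RawHom X Y → RawHom Y X
f † = ⟨ up f , low f ⟩

zeroR : (X Y : OStr) → RawHom X Y
zeroR X Y = ⟨ (λ _ → OStr.𝟙 Y) , (λ _ → OStr.𝟙 X) ⟩

↓ : (X : OStr) → IsOML X → OStr.Carrier X → OStr
↓ X oml k = record
  { Carrier = Σ[ u ∈ Carrier ] u ≤ k
  ; _≈_     = λ u v → proj₁ u ≈ proj₁ v
  ; _≤_     = λ u v → proj₁ u ≤ proj₁ v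
  ; _∨_     = λ u v → (proj₁ u ∨ proj₁ v) , ∨-least (proj₂ u) (proj₂ v)
  ; _∧_     = λ u v → (proj₁ u ∧ proj₁ v) , trans (x∧y≤x _ _) (proj₂ u)
  ; 𝟙       = k , refl
  ; 𝟘       = 𝟘 , minimum k
  ; _ᗮ      = λ u → (k ∧ (proj₁ u ᗮ)) , x∧y≤x _ _
  }
  where
  open OStr X
  open IsOML oml

kerObj : (X : OStr) → IsOML X → ∀ {Y} → RawHom X Y → OStr
kerObj X oml {Y} f = ↓ X oml (up f (OStr.𝟙 Y))

ker : (X : OStr) (oml : IsOML X) {Y : OStr} (f : RawHom X Y) → RawHom (kerObj X oml f) X
ker X oml {Y} f = ⟨ (λ u → proj₁ u ᗮ) , (λ x → (k ∧ (x ᗮ)) , x∧y≤x _ _) ⟩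
  where
  open OStr X
  open IsOML oml
  k = up f (OStr.𝟙 Y)

_≤K_ : ∀ {A B X} → RawHom A X → RawHom B X → Set
_≤K_ {A} {B} m n = Σ[ φ ∈ Hom A B ] ((n ∘R raw φ) ≋ m)

𝟎 : OStr
𝟎 = record
  { Carrier = ⊤ ; _≈_ = λ _ _ → ⊤ ; _≤_ = λ _ _ → ⊤
  ; _∨_ = λ _ _ → tt ; _∧_ = λ _ _ → tt ; 𝟙 = tt ; 𝟘 = tt ; _ᗮ = λ _ → tt }

infixr 5 _⊕_
_⊕_ : OStr → OStr → OStr
X₁ ⊕ X₂ = record
  { Carrier = X₁.Carrier × X₂.Carrier
  ; _≈_ = λ u v → (proj₁ u X₁.≈ proj₁ v) × (proj₂ u X₂.≈ proj₂ v)
  ; _≤_ = λ u v → (proj₁ u X₁.≤ proj₁ v) × (proj₂ u X₂.≤ proj₂ v)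
  ; _∨_ = λ u v → (proj₁ u X₁.∨ proj₁ v) , (proj₂ u X₂.∨ proj₂ v)
  ; _∧_ = λ u v → (proj₁ u X₁.∧ proj₁ v) , (proj₂ u X₂.∧ proj₂ v)
  ; 𝟙 = X₁.𝟙 , X₂.𝟙 ; 𝟘 = X₁.𝟘 , X₂.𝟘
  ; _ᗮ = λ u → (proj₁ u X₁.ᗮ) , (proj₂ u X₂.ᗮ) }
  where
  module X₁ = OStr X₁
  module X₂ = OStr X₂

module Submission where

-- The kernel of f : X → Y is the canonical map ι k : ↓k → X with k = f^*(1),
-- so kernels into X are governed by the elements of X.  Most of the work
-- holds in any orthomodular lattice X and is done in the module
-- 'Orthomodular':
--   * ↓c is again an orthomodular lattice (orthocomplement u ↦ c ∧ uᗮ);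
--   * ι a ≤ ι c in KSub(X) iff a ≤ c, so KSub(X) is the lattice X itself;
--   * every element c is (up to ᗮᗮ) the kernel of the "cokernel" (ι cᗮ)†;
--   * if k ≤ lᗮ then (ι k)† ∘ ι l is the zero map.
-- The module 'Boolean' adds distributivity: ↓c is again Boolean, and
-- disjoint elements are orthogonal (k ∧ l = 0 ⇒ k ≤ lᗮ), which fails in a
-- general orthomodular lattice.  Hence if ker f ∧ ker g = 0 in KSub(X), the
-- elements k = f^*(1), l = g^*(1) are disjoint, thus orthogonal, and
-- (ker f)† ∘ ker g = 0.  Closure under the zero object and ⊕ is
-- componentwise.

open import Defs
open import Data.Product using (Σ-syntax; _×_; _,_; proj₁; proj₂)
open import Data.Product.Relation.Binary.Pointwise.NonDependent using (×-isPartialOrder)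
open import Function.Bundles using (mk⇔)
import Function.Properties.Equivalence as ⇔
open import Relation.Binary.Lattice.Bundles using (BoundedLattice)
import Relation.Binary.Construct.On as On
import Relation.Binary.Lattice.Properties.MeetSemilattice as MeetProperties
import Relation.Binary.Lattice.Properties.JoinSemilattice as JoinProperties
import Relation.Binary.Reasoning.PartialOrder as ≤-Reasoning

-- The dagger of a morphism of OMLatGal is again a morphism: the Galois
-- condition is symmetric in f_* and f^*.
dagger : ∀ {A C} → Hom A C → Hom C A
dagger f = record
  { raw          = raw f †
  ; low-antitone = up-antitone f
  ; up-antitone  = low-antitone f
  ; galois       = λ y x → ⇔.sym (galois f x y)
  }

module Orthomodular (X : OStr) (oml : IsOML X) where
  open OStr X
  open IsOML oml

  boundedLattice : BoundedLattice _ _ _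
  boundedLattice = record { isBoundedLattice = isBoundedLattice }

  open BoundedLattice boundedLattice using (poset; meetSemilattice; joinSemilattice)
  open MeetProperties meetSemilattice using (∧-comm; ∧-cong; ∧-monotonic)
  open JoinProperties joinSemilattice using (∨-cong)
  open ≤-Reasoning poset

  ≥-reflexive : ∀ {x y} → x ≈ y → y ≤ x
  ≥-reflexive e = reflexive (Eq.sym e)

  ∧-absorbʳ : ∀ {x y} → x ≤ y → x ∧ y ≈ x
  ∧-absorbʳ p = antisym (x∧y≤x _ _) (∧-greatest refl p)

  ᗮ-cong : ∀ {x y} → x ≈ y → x ᗮ ≈ y ᗮ
  ᗮ-cong e = antisym (ᗮ-antitone (≥-reflexive e)) (ᗮ-antitone (reflexive e))

  ᗮ-injective : ∀ {x y} → x ᗮ ≈ y ᗮ → x ≈ y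
  ᗮ-injective {x} {y} e = begin-equality
    x       ≈⟨ ᗮ-involutive x ⟨
    x ᗮ ᗮ   ≈⟨ ᗮ-cong e ⟩
    y ᗮ ᗮ   ≈⟨ ᗮ-involutive y ⟩
    y       ∎

  ⊥-sym : ∀ {x y} → x ≤ y ᗮ → y ≤ x ᗮ
  ⊥-sym {x} {y} p = begin
    y       ≈⟨ ᗮ-involutive y ⟨
    y ᗮ ᗮ   ≤⟨ ᗮ-antitone p ⟩
    x ᗮ     ∎

  𝟙ᗮ≈𝟘 : 𝟙 ᗮ ≈ 𝟘
  𝟙ᗮ≈𝟘 = begin-equality
    𝟙 ᗮ       ≈⟨ ∧-absorbʳ (maximum _) ⟨
    𝟙 ᗮ ∧ 𝟙   ≈⟨ ∧-comm _ _ ⟩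
    𝟙 ∧ 𝟙 ᗮ   ≈⟨ ∧-ᗮ 𝟙 ⟩
    𝟘         ∎

  excluded-middle : ∀ x → 𝟙 ≤ x ∨ x ᗮ
  excluded-middle x = begin
    𝟙                   ≤⟨ ⊥-sym (minimum _) ⟩
    𝟘 ᗮ                 ≤⟨ ᗮ-antitone (reflexive (∧-ᗮ x)) ⟩
    (x ∧ x ᗮ) ᗮ         ≤⟨ ᗮ-antitone below ⟩
    (x ∨ x ᗮ) ᗮ ᗮ       ≈⟨ ᗮ-involutive _ ⟩
    x ∨ x ᗮ             ∎
    where
    below : (x ∨ x ᗮ) ᗮ ≤ x ∧ x ᗮ
    below = ∧-greatest (trans (ᗮ-antitone (y≤x∨y _ _)) (reflexive (ᗮ-involutive x)))
                       (ᗮ-antitone (x≤x∨y _ _))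

  -- Orthomodularity
  -- applied to u ≤ w := c ∧ (c ∧ uᗮ)ᗮ gives w = u ∨ (uᗮ ∧ w), and
  -- uᗮ ∧ w lies below both c ∧ uᗮ and its complement, hence is 𝟘.
  ↓-involutive : ∀ {c u} → u ≤ c → c ∧ (c ∧ u ᗮ) ᗮ ≈ u
  ↓-involutive {c} {u} u≤c = antisym w≤u u≤w
    where
    t = c ∧ u ᗮ
    w = c ∧ t ᗮ
    u≤w : u ≤ w
    u≤w = ∧-greatest u≤c (⊥-sym (x∧y≤y _ _))
    rest≤𝟘 : u ᗮ ∧ w ≤ 𝟘
    rest≤𝟘 = begin
      u ᗮ ∧ w   ≤⟨ ∧-greatest (∧-greatest (trans (x∧y≤y _ _) (x∧y≤x _ _)) (x∧y≤x _ _))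
                              (trans (x∧y≤y _ _) (x∧y≤y _ _)) ⟩
      t ∧ t ᗮ   ≈⟨ ∧-ᗮ t ⟩
      𝟘         ∎
    w≤u : w ≤ u
    w≤u = begin
      w                ≈⟨ orthomodular u≤w ⟩
      u ∨ (u ᗮ ∧ w)    ≤⟨ ∨-least refl (trans rest≤𝟘 (minimum u)) ⟩
      u                ∎

  ∧-absorb-below : ∀ {a c} z → a ≤ c → a ∧ (c ∧ z) ≈ a ∧ z
  ∧-absorb-below z a≤c =
    antisym (∧-monotonic refl (x∧y≤y _ _))
            (∧-greatest (x∧y≤x _ _) (∧-monotonic a≤c refl))

  ↓-isOML : ∀ c → IsOML (↓ X oml c)
  ↓-isOML c = record
    { isBoundedLattice = record
      { isLattice = record
        { isPartialOrder = On.isPartialOrder proj₁ isPartialOrder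
        ; supremum       = λ _ _ → x≤x∨y _ _ , y≤x∨y _ _ , λ _ → ∨-least
        ; infimum        = λ _ _ → x∧y≤x _ _ , x∧y≤y _ _ , λ _ → ∧-greatest
        }
      ; maximum = proj₂
      ; minimum = λ u → minimum (proj₁ u)
      }
    ; ᗮ-involutive = λ u → ↓-involutive (proj₂ u)
    ; ᗮ-antitone   = λ p → ∧-monotonic refl (ᗮ-antitone p)
    ; ∧-ᗮ          = λ u → antisym (trans (∧-monotonic refl (x∧y≤y _ _))
                                          (reflexive (∧-ᗮ (proj₁ u))))
                                   (minimum _)
    ; orthomodular = λ {u} {v} u≤v → Eq.trans (orthomodular u≤v)
                       (∨-cong Eq.refl (Eq.sym (relative-complement (proj₂ v))))
    }
    where
    relative-complement : ∀ {u v} → v ≤ c → (c ∧ u ᗮ) ∧ v ≈ u ᗮ ∧ v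
    relative-complement {u} {v} v≤c = begin-equality
      (c ∧ u ᗮ) ∧ v   ≈⟨ ∧-comm _ _ ⟩
      v ∧ (c ∧ u ᗮ)   ≈⟨ ∧-absorb-below (u ᗮ) v≤c ⟩
      v ∧ u ᗮ         ≈⟨ ∧-comm _ _ ⟩
      u ᗮ ∧ v         ∎

  -- The canonical map ι c : ↓c → X; ker f is ι (f^*(1)) by definition.
  ι : ∀ c → RawHom (↓ X oml c) X
  ι c = ⟨ (λ u → proj₁ u ᗮ) , (λ x → (c ∧ x ᗮ) , x∧y≤x _ _) ⟩

  ι-Hom : ∀ c → Hom (↓ X oml c) X
  ι-Hom c = record
    { raw          = ι c
    ; low-antitone = ᗮ-antitone
    ; up-antitone  = λ p → ∧-monotonic refl (ᗮ-antitone p)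
    ; galois       = λ u x → mk⇔ (λ p → ⊥-sym (trans p (x∧y≤y _ _)))
                                 (λ q → ∧-greatest (proj₂ u) (⊥-sym q))
    }

  -- Every element is a kernel: the kernel of the "cokernel" (ι cᗮ)† of c
  -- is ι (cᗮᗮ), i.e. ι c up to the isomorphism cᗮᗮ ≈ c.
  cokernel : ∀ c → Hom X (↓ X oml (c ᗮ))
  cokernel c = dagger (ι-Hom (c ᗮ))

  -- The canonical morphism ↓a → ↓c, u ↦ c ∧ uᗮ; for a ≤ c it factors
  -- ι a through ι c.
  ↓-transfer : ∀ a c → Hom (↓ X oml a) (↓ X oml c)
  ↓-transfer a c = record
    { raw          = ⟨ (λ u → (c ∧ proj₁ u ᗮ) , x∧y≤x _ _)
                     , (λ v → (a ∧ proj₁ v ᗮ) , x∧y≤x _ _) ⟩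
    ; low-antitone = λ p → ∧-monotonic refl (ᗮ-antitone p)
    ; up-antitone  = λ p → ∧-monotonic refl (ᗮ-antitone p)
    ; galois       = λ u v →
        mk⇔ (λ p → ∧-greatest (proj₂ v) (⊥-sym (trans p (x∧y≤y _ _))))
            (λ q → ∧-greatest (proj₂ u) (⊥-sym (trans q (x∧y≤y _ _))))
    }

  ≤⇒≤K : ∀ {a c} → a ≤ c → ι a ≤K ι c
  ≤⇒≤K {a} {c} a≤c = ↓-transfer a c , low-eq , up-eq
    where
    low-eq : ∀ (u : Σ[ u ∈ Carrier ] u ≤ a) → (c ∧ (c ∧ proj₁ u ᗮ) ᗮ) ᗮ ≈ proj₁ u ᗮ
    low-eq u = ᗮ-cong (↓-involutive (trans (proj₂ u) a≤c))
    up-eq : ∀ x → a ∧ (c ∧ (c ∧ x ᗮ) ᗮ) ᗮ ≈ a ∧ x ᗮ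
    up-eq x = begin-equality
      a ∧ (c ∧ (c ∧ x ᗮ) ᗮ) ᗮ           ≈⟨ ∧-absorb-below _ a≤c ⟨
      a ∧ (c ∧ (c ∧ (c ∧ x ᗮ) ᗮ) ᗮ)     ≈⟨ ∧-cong Eq.refl (↓-involutive (x∧y≤x _ _)) ⟩
      a ∧ (c ∧ x ᗮ)                     ≈⟨ ∧-absorb-below _ a≤c ⟩
      a ∧ x ᗮ                           ∎

  -- Order in KSub(X) yields order in X: evaluate the lower components of
  -- the factorisation at the top element a of ↓a.
  ≤K⇒≤ : ∀ {a c} → ι a ≤K ι c → a ≤ c
  ≤K⇒≤ {a} {c} (φ , low-eq , _) = begin
    a                                      ≈⟨ ᗮ-injective (low-eq (a , refl)) ⟨
    c ∧ proj₁ (low (raw φ) (a , refl)) ᗮ   ≤⟨ x∧y≤x _ _ ⟩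
    c                                      ∎

  orthogonal⇒zero : ∀ {k l} → k ≤ l ᗮ →
                    ((ι k †) ∘R ι l) ≋ zeroR (↓ X oml l) (↓ X oml k)
  orthogonal⇒zero k≤lᗮ =
    (λ u → ∧-absorbʳ (⊥-sym (below-double-ᗮ (proj₂ u) (⊥-sym k≤lᗮ))))
    , (λ v → ∧-absorbʳ (⊥-sym (below-double-ᗮ (proj₂ v) k≤lᗮ)))
    where
    below-double-ᗮ : ∀ {u m n} → u ≤ m → m ≤ n → u ᗮ ᗮ ≤ n
    below-double-ᗮ {u} u≤m m≤n = trans (reflexive (ᗮ-involutive u)) (trans u≤m m≤n)

module Boolean (X : OStr) (B : IsBool X) where
  open OStr X
  open IsBool B
  open Orthomodular X isOML
  open ≤-Reasoning (BoundedLattice.poset boundedLattice)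

  ↓-isBool : ∀ c → IsBool (↓ X isOML c)
  ↓-isBool c = record
    { isOML        = ↓-isOML c
    ; ∧-distribˡ-∨ = λ u v w → ∧-distribˡ-∨ (proj₁ u) (proj₁ v) (proj₁ w)
    }

  disjoint⇒orthogonal : ∀ {k l} → k ∧ l ≤ 𝟘 → k ≤ l ᗮ
  disjoint⇒orthogonal {k} {l} k∧l≤𝟘 = begin
    k                       ≤⟨ ∧-greatest refl (trans (maximum k) (excluded-middle l)) ⟩
    k ∧ (l ∨ l ᗮ)           ≈⟨ ∧-distribˡ-∨ k l (l ᗮ) ⟩
    (k ∧ l) ∨ (k ∧ l ᗮ)     ≤⟨ ∨-least (trans k∧l≤𝟘 (minimum _)) (x∧y≤y _ _) ⟩
    l ᗮ                     ∎

  -- m ∧ n = 0 in KSub(X): every kernel (of a map into a Boolean algebra)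
  -- below both m and n is below the zero kernel ker id.
  KSubDisjoint : ∀ {A C} → RawHom A X → RawHom C X → Set₁
  KSubDisjoint m n = (W : OStr) → IsBool W → (h : Hom X W) →
    ker X isOML (raw h) ≤K m → ker X isOML (raw h) ≤K n →
    ker X isOML (raw h) ≤K ker X isOML (idR X)

  -- Disjointness in KSub(X) is disjointness in X: test it against the
  -- cokernel of k ∧ l, whose kernel is ι (k ∧ l) up to ᗮᗮ.
  KSubDisjoint⇒disjoint : ∀ {k l} → KSubDisjoint (ι k) (ι l) → k ∧ l ≤ 𝟘
  KSubDisjoint⇒disjoint {k} {l} disjoint = begin
    k ∧ l               ≈⟨ ᗮ-involutive (k ∧ l) ⟨
    (k ∧ l) ᗮ ᗮ         ≤⟨ ≤K⇒≤ meet≤zero ⟩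
    𝟙 ᗮ                 ≈⟨ 𝟙ᗮ≈𝟘 ⟩
    𝟘                   ∎
    where
    j = k ∧ l
    j≈ : j ᗮ ᗮ ≈ j
    j≈ = ᗮ-involutive j
    meet≤zero : ι (j ᗮ ᗮ) ≤K ι (𝟙 ᗮ)
    meet≤zero = disjoint (↓ X isOML (j ᗮ)) (↓-isBool (j ᗮ)) (cokernel j)
                  (≤⇒≤K (trans (reflexive j≈) (x∧y≤x _ _)))
                  (≤⇒≤K (trans (reflexive j≈) (x∧y≤y _ _)))

  KSub-Boolean : ∀ {k l} → KSubDisjoint (ι k) (ι l) →
                 ((ι k †) ∘R ι l) ≋ zeroR (↓ X isOML l) (↓ X isOML k)
  KSub-Boolean disjoint =
    orthogonal⇒zero (disjoint⇒orthogonal (KSubDisjoint⇒disjoint disjoint))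

-- The zero object is the one-element Boolean algebra; every law is an
-- inhabitant of ⊤, so the whole record is found by eta-expansion.
𝟎-isBool : IsBool 𝟎
𝟎-isBool = _

⊕-isBool : (X₁ X₂ : OStr) → IsBool X₁ → IsBool X₂ → IsBool (X₁ ⊕ X₂)
⊕-isBool X₁ X₂ B₁ B₂ = record
  { isOML = record
    { isBoundedLattice = record
      { isLattice = record
        { isPartialOrder = ×-isPartialOrder A.isPartialOrder C.isPartialOrder
        ; supremum = λ _ _ → (A.x≤x∨y _ _ , C.x≤x∨y _ _) , (A.y≤x∨y _ _ , C.y≤x∨y _ _) ,
                       λ _ p q → A.∨-least (proj₁ p) (proj₁ q) , C.∨-least (proj₂ p) (proj₂ q)
        ; infimum  = λ _ _ → (A.x∧y≤x _ _ , C.x∧y≤x _ _) , (A.x∧y≤y _ _ , C.x∧y≤y _ _) ,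
                       λ _ p q → A.∧-greatest (proj₁ p) (proj₁ q) , C.∧-greatest (proj₂ p) (proj₂ q)
        }
      ; maximum = λ u → A.maximum (proj₁ u) , C.maximum (proj₂ u)
      ; minimum = λ u → A.minimum (proj₁ u) , C.minimum (proj₂ u)
      }
    ; ᗮ-involutive = λ u → A.ᗮ-involutive (proj₁ u) , C.ᗮ-involutive (proj₂ u)
    ; ᗮ-antitone   = λ p → A.ᗮ-antitone (proj₁ p) , C.ᗮ-antitone (proj₂ p)
    ; ∧-ᗮ          = λ u → A.∧-ᗮ (proj₁ u) , C.∧-ᗮ (proj₂ u)
    ; orthomodular = λ p → A.orthomodular (proj₁ p) , C.orthomodular (proj₂ p)
    }
  ; ∧-distribˡ-∨ = λ u v w → A.∧-distribˡ-∨ (proj₁ u) (proj₁ v) (proj₁ w)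
                           , C.∧-distribˡ-∨ (proj₂ u) (proj₂ v) (proj₂ w)
  }
  where
  module A = IsBool B₁
  module C = IsBool B₂

proposition3p15 :
    ((X Y : OStr) (bX : IsBool X) → IsBool Y → (f : Hom X Y) →
        IsBool (kerObj X (IsBool.isOML bX) (raw f)))
    × IsBool 𝟎
    × ((X₁ X₂ : OStr) → IsBool X₁ → IsBool X₂ → IsBool (X₁ ⊕ X₂))
    × ((X Y Z : OStr) (bX : IsBool X) → IsBool Y → IsBool Z →
        (f : Hom X Y) (g : Hom X Z) →
        ((W : OStr) → IsBool W → (h : Hom X W) →
            ker X (IsBool.isOML bX) (raw h) ≤K ker X (IsBool.isOML bX) (raw f) →
            ker X (IsBool.isOML bX) (raw h) ≤K ker X (IsBool.isOML bX) (raw g) →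
            ker X (IsBool.isOML bX) (raw h) ≤K ker X (IsBool.isOML bX) (idR X)) →
        ((ker X (IsBool.isOML bX) (raw f) †) ∘R ker X (IsBool.isOML bX) (raw g))
          ≋ zeroR (kerObj X (IsBool.isOML bX) (raw g)) (kerObj X (IsBool.isOML bX) (raw f)))
proposition3p15 =
    (λ X _ bX _ _ → Boolean.↓-isBool X bX _)
  , 𝟎-isBool
  , ⊕-isBool
  , (λ X _ _ bX _ _ _ _ disjoint → Boolean.KSub-Boolean X bX disjoint)
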